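{- Over the field $\mathbb{F}=\mathbb{F}_2$, $\mathbf{VNP}_1\subsetneq\mathbf{VNP}$.
   Context: $\mathbf{VP}_1$ is the class of families $(f_n)$ (in polynomially many variables) computable by polynomial-size width-1 algebraic branching programs with arbitrary affine linear forms over $\mathbb{F}$ as edge labels, i.e. $f_n$ is a product of polynomially many affine linear forms. For a class $\mathbf{C}$, $\mathrm{N}(\mathbf{C})$ consists of families $(f_n)$ for which there are $(g_n)\in\mathbf{C}$ and polynomially bounded $p,q$ with $f_n(\mathbf{x})=\sum_{\mathbf{b}\in\{0,1\}^{p(n)}}g_{q(n)}(\mathbf{b},\mathbf{x})$; $\mathbf{VNP}_1=\mathrm{N}(\mathbf{VP}_1)$. $\mathbf{VNP}$ is Valiant's class of p-definable families, equal to $\mathrm{N}(\mathbf{VP}_e)$ with $\mathbf{VP}_e$ the families of polynomially bounded arithmetic formula size. -}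

module Defs where

open import Data.Bool using (Bool; true; false; _xor_; _∧_)
open import Data.Nat using (ℕ; zero; suc; _+_; _*_; _∸_; _^_; _≤_; _<_; _≡ᵇ_)
open import Data.List using (List; []; _∷_; map; foldr; concatMap; upTo; length; _++_)
open import Data.List.Relation.Unary.All using (All)
open import Data.Product using (Σ; ∃; ∃-syntax; _×_; _,_; proj₁; proj₂)
open import Data.Unit using (⊤)
open import Relation.Binary.PropositionalEquality using (_≡_)

-- The field F = F₂ is represented by Bool (addition = xor, product = ∧).
-- Arithmetic expressions (= arithmetic formulas, being trees) over F₂
-- in the variables x₀, x₁, x₂, …

infixl 6 _⊕_
infixl 7 _⊗_

data Expr : Set where
  var   : ℕ → Expr
  const : Bool → Expr
  _⊕_   : Expr → Expr → Expr
  _⊗_   : Expr → Expr → Expr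

-- Formal polynomial semantics: coefficient of a monomial.
-- A monomial is an exponent list [e₀, e₁, …, e_{k-1}] for x₀^e₀ ⋯ ;
-- missing trailing exponents are 0.

Monomial : Set
Monomial = List ℕ

allZero : Monomial → Bool
allZero []      = true
allZero (a ∷ m) = (a ≡ᵇ 0) ∧ allZero m

isVarMono : ℕ → Monomial → Bool
isVarMono i       []      = false
isVarMono zero    (a ∷ m) = (a ≡ᵇ 1) ∧ allZero m
isVarMono (suc i) (a ∷ m) = (a ≡ᵇ 0) ∧ isVarMono i m

splits : Monomial → List (Monomial × Monomial)
splits []      = ([] , []) ∷ []
splits (a ∷ m) =
  concatMap (λ i → map (λ uv → (i ∷ proj₁ uv , (a ∸ i) ∷ proj₂ uv)) (splits m))
            (upTo (suc a))

xorList : List Bool → Bool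
xorList = foldr _xor_ false

coeff : Expr → Monomial → Bool
coeff (var i)   m = isVarMono i m
coeff (const c) m = c ∧ allZero m
coeff (e ⊕ f)   m = coeff e m xor coeff f m
coeff (e ⊗ f)   m =
  xorList (map (λ uv → coeff e (proj₁ uv) ∧ coeff f (proj₂ uv)) (splits m))

-- equality as formal polynomials in F₂[x₀, x₁, …]
infix 4 _≈_
_≈_ : Expr → Expr → Set
e ≈ f = ∀ m → coeff e m ≡ coeff f m

size : Expr → ℕ
size (var _)   = 1
size (const _) = 1
size (e ⊕ f)   = suc (size e + size f)
size (e ⊗ f)   = suc (size e + size f)

VarsBelow : ℕ → Expr → Set
VarsBelow k (var i)   = i < k
VarsBelow k (const _) = ⊤
VarsBelow k (e ⊕ f)   = VarsBelow k e × VarsBelow k f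
VarsBelow k (e ⊗ f)   = VarsBelow k e × VarsBelow k f

subst : (ℕ → Expr) → Expr → Expr
subst σ (var i)   = σ i
subst σ (const c) = const c
subst σ (e ⊕ f)   = subst σ e ⊕ subst σ f
subst σ (e ⊗ f)   = subst σ e ⊗ subst σ f

Family : Set
Family = ℕ → Expr

PolyBounded : (ℕ → ℕ) → Set
PolyBounded p = ∃[ c ] (∀ n → p n ≤ c * n ^ c + c)

VPe : Family → Set
VPe f = ∃[ s ] (PolyBounded s × (∀ n → ∃[ φ ]
          (size φ ≤ s n × VarsBelow (s n) φ × φ ≈ f n)))

-- VP_1 : products of polynomially many affine linear forms.
-- Over F₂ an affine linear form is c + Σ_{i ∈ vs} x_i.
Affine : Set
Affine = Bool × List ℕ

affineExpr : Affine → Expr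
affineExpr (c , vs) = foldr (λ i e → var i ⊕ e) (const c) vs

AffineVarsBelow : ℕ → Affine → Set
AffineVarsBelow k (c , vs) = All (_< k) vs

prodExpr : List Expr → Expr
prodExpr = foldr _⊗_ (const true)

VP1 : Family → Set
VP1 f = ∃[ s ] (PolyBounded s × (∀ n → ∃[ L ]
          (length L ≤ s n × All (AffineVarsBelow (s n)) L ×
           prodExpr (map affineExpr L) ≈ f n)))

-- The N(·) operator: f_n(x) = Σ_{b ∈ {0,1}^{p(n)}} g_{q(n)}(b, x)

allBits : ℕ → List (List Bool)
allBits zero    = [] ∷ []
allBits (suc p) = map (false ∷_) (allBits p) ++ map (true ∷_) (allBits p)

-- substitution y ↦ (b, x): the first |b| variables get the bits of b,
-- variable number |b| + j becomes x_j
bitSub : List Bool → ℕ → Expr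
bitSub []       i       = var i
bitSub (b ∷ bs) zero    = const b
bitSub (b ∷ bs) (suc i) = bitSub bs i

cubeSum : ℕ → Expr → Expr
cubeSum p g = foldr (λ b acc → subst (bitSub b) g ⊕ acc) (const false) (allBits p)

N : (Family → Set) → Family → Set
N C f = ∃[ g ] (C g × ∃[ p ] ∃[ q ] (PolyBounded p × PolyBounded q ×
          (∀ n → f n ≈ cubeSum (p n) (g (q n)))))

VNP : Family → Set
VNP = N VPe

VNP1 : Family → Set
VNP1 = N VP1

_⊆ᶜ_ : (Family → Set) → (Family → Set) → Set
C ⊆ᶜ D = ∀ f → C f → D f

_⊊ᶜ_ : (Family → Set) → (Family → Set) → Set
C ⊊ᶜ D = (C ⊆ᶜ D) × ((D ⊆ᶜ C) → ⊥)
  where open import Data.Empty using (⊥)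

module Submission where

-- A product of s affine forms over variables below s is a formula
-- of size O(s²): over F₂ each form c + Σ x_v only depends on the parity of the
-- multiplicity of each variable, so it can be rewritten as c + Σ_{j ∈ J} x_j
-- with J ⊆ {0, …, s-1} (normalForm).  Hence VP₁ ⊆ VPₑ and so N(VP₁) ⊆ N(VPₑ).
--
-- Evaluate polynomials at points ρ ∈ F₂^ℕ.  A product of affine
-- forms is the indicator of an affine subspace, i.e. of a set closed under
-- ρ₁ + ρ₂ + ρ₃ (ThreeClosed).  The value of Σ_b g(b, ρ) is the parity of the
-- fibre over ρ, and if the fibres over ρ₁, ρ₂, ρ₃ are odd, the fibre over
-- ρ₁ + ρ₂ + ρ₃ is a translate of the fibre over ρ₁; so every VNP₁ polynomial is
-- three-closed as a function.  x₀ ∨ x₁ ∈ VNP is 1 at (1,0), (0,1), (1,1) but 0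
-- at their sum (0,0).
--
-- Since the classes are defined up to formal equality ≈ of coefficients, the
-- bridge is eval-≈: equal coefficients give equal values.  It is proved by
-- writing eval ρ e as a box sum Σ_{m ∈ [0,D]^K} coeff e m · ρ^m; the product
-- case is the Cauchy product formula for coefficient functions of bounded
-- individual degree (boxSum-⋆).

open import Algebra.Bundles using (CommutativeRing; CommutativeMonoid)
open import Data.Bool using (Bool; true; false; _xor_; _∧_; _∨_; if_then_else_)
open import Data.Bool.Properties
  using (xor-assoc; xor-comm; xor-same; xor-identityʳ; ∧-comm; ∧-zeroʳ; ∧-identityʳ;
         ∧-distribˡ-xor; ∧-distribʳ-xor; xor-∧-commutativeRing; ∧-commutativeMonoid)
open import Data.Empty using (⊥; ⊥-elim)
open import Data.List using (List; []; _∷_; map; foldr; concatMap; upTo; applyUpTo; _++_; _∷ʳ_; length; zipWith)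
open import Data.List.Properties using (map-++; map-∘; map-cong; applyUpTo-∷ʳ; length-map)
open import Data.List.Relation.Unary.All using (All; []; _∷_; universal)
import Data.List.Relation.Unary.All as All
open import Data.List.Relation.Unary.All.Properties using (map⁺; ++⁺)
open import Data.List.Relation.Unary.Any using (Any; here; there)
import Data.List.Relation.Unary.Any as Any
open import Data.Nat using (ℕ; zero; suc; _+_; _*_; _^_; _∸_; _≤_; _<_; _≡ᵇ_; z≤n; s≤s; _≤?_; s≤s⁻¹)
open import Data.Nat.Properties
open import Data.Nat.Solver using (module +-*-Solver)
open import Data.Product using (_×_; _,_; proj₁; proj₂; ∃-syntax)
open import Data.Sum using (inj₁; inj₂)
open import Data.Unit using (⊤; tt)
open import Function using (_∘_; id)
open import Relation.Nullary using (yes; no; ¬_)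
open import Relation.Binary.PropositionalEquality hiding (subst)
open import Relation.Binary.PropositionalEquality using () renaming (subst to ≡-subst)
open import Algebra.Properties.CommutativeSemigroup
  (CommutativeRing.+-commutativeSemigroup xor-∧-commutativeRing)
  using () renaming (interchange to xor-interchange; x∙yz≈y∙xz to xor-swapˡ)
open import Algebra.Properties.CommutativeSemigroup
  (CommutativeMonoid.commutativeSemigroup ∧-commutativeMonoid)
  using () renaming (x∙yz≈y∙xz to ∧-swapˡ; interchange to ∧-interchange)
open import Defs

xorSum : ℕ → (ℕ → Bool) → Bool
xorSum zero    h = false
xorSum (suc n) h = xorSum n h xor h n

xorSum-cong : ∀ n {h h′ : ℕ → Bool} → (∀ i → i < n → h i ≡ h′ i) → xorSum n h ≡ xorSum n h′
xorSum-cong zero    eq = refl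
xorSum-cong (suc n) eq = cong₂ _xor_ (xorSum-cong n (λ i i<n → eq i (m<n⇒m<1+n i<n))) (eq n ≤-refl)

xorSum-false : ∀ n {h : ℕ → Bool} → (∀ i → i < n → h i ≡ false) → xorSum n h ≡ false
xorSum-false zero    eq = refl
xorSum-false (suc n) eq =
  cong₂ _xor_ (xorSum-false n (λ i i<n → eq i (m<n⇒m<1+n i<n))) (eq n ≤-refl)

xorSum-xor : ∀ n (h h′ : ℕ → Bool) → xorSum n (λ i → h i xor h′ i) ≡ xorSum n h xor xorSum n h′
xorSum-xor zero    h h′ = refl
xorSum-xor (suc n) h h′ =
  trans (cong (_xor (h n xor h′ n)) (xorSum-xor n h h′))
        (xor-interchange (xorSum n h) (xorSum n h′) (h n) (h′ n))

xorSum-∧ˡ : ∀ n b (h : ℕ → Bool) → xorSum n (λ i → b ∧ h i) ≡ b ∧ xorSum n h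
xorSum-∧ˡ zero    b h = sym (∧-zeroʳ b)
xorSum-∧ˡ (suc n) b h =
  trans (cong (_xor (b ∧ h n)) (xorSum-∧ˡ n b h)) (sym (∧-distribˡ-xor b (xorSum n h) (h n)))

xorSum-∧ʳ : ∀ n b (h : ℕ → Bool) → xorSum n (λ i → h i ∧ b) ≡ xorSum n h ∧ b
xorSum-∧ʳ n b h =
  trans (xorSum-cong n (λ i _ → ∧-comm (h i) b)) (trans (xorSum-∧ˡ n b h) (∧-comm b (xorSum n h)))

xorSum-trunc : ∀ m n {h : ℕ → Bool} → (∀ i → m ≤ i → h i ≡ false) → m ≤ n → xorSum n h ≡ xorSum m h
xorSum-trunc m zero    eq z≤n = refl
xorSum-trunc m (suc n) {h} eq m≤1+n with m≤n⇒m<n∨m≡n m≤1+n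
... | inj₁ m<1+n = trans (cong (xorSum n h xor_) (eq n (m<1+n⇒m≤n m<1+n)))
                         (trans (xor-identityʳ _) (xorSum-trunc m n eq (m<1+n⇒m≤n m<1+n)))
... | inj₂ refl  = refl

≡ᵇ-refl : ∀ v → (v ≡ᵇ v) ≡ true
≡ᵇ-refl zero    = refl
≡ᵇ-refl (suc v) = ≡ᵇ-refl v

≢⇒≡ᵇ-false : ∀ i v → i ≢ v → (i ≡ᵇ v) ≡ false
≢⇒≡ᵇ-false zero    zero    ne = ⊥-elim (ne refl)
≢⇒≡ᵇ-false zero    (suc v) ne = refl
≢⇒≡ᵇ-false (suc i) zero    ne = refl
≢⇒≡ᵇ-false (suc i) (suc v) ne = ≢⇒≡ᵇ-false i v (ne ∘ cong suc)

xorSum-δ : ∀ n v (h : ℕ → Bool) → v < n → xorSum n (λ i → (i ≡ᵇ v) ∧ h i) ≡ h v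
xorSum-δ (suc n) v h v<1+n with m<1+n⇒m<n∨m≡n v<1+n
... | inj₁ v<n =
  trans (cong (xorSum n (λ i → (i ≡ᵇ v) ∧ h i) xor_) (cong (_∧ h n) (≢⇒≡ᵇ-false n v (>⇒≢ v<n))))
        (trans (xor-identityʳ _) (xorSum-δ n v h v<n))
... | inj₂ refl =
  cong₂ _xor_ (xorSum-false n (λ i i<n → cong (_∧ h i) (≢⇒≡ᵇ-false i v (<⇒≢ i<n))))
              (cong (_∧ h v) (≡ᵇ-refl v))

xorSum-triangle : ∀ N (P Q : ℕ → Bool) →
  xorSum N (λ a → xorSum (suc a) (λ i → P i ∧ Q (a ∸ i))) ≡ xorSum N (λ i → P i ∧ xorSum (N ∸ i) Q)
xorSum-triangle zero    P Q = refl
xorSum-triangle (suc N) P Q = trans (cong (_xor new) (xorSum-triangle N P Q)) (sym split)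
  where
  old = xorSum N (λ i → P i ∧ xorSum (N ∸ i) Q)
  new = xorSum (suc N) (λ i → P i ∧ Q (N ∸ i))
  -- the row of index N contributes exactly the diagonal a = N
  split : xorSum (suc N) (λ i → P i ∧ xorSum (suc N ∸ i) Q) ≡ old xor new
  split = begin
    xorSum (suc N) (λ i → P i ∧ xorSum (suc N ∸ i) Q)
      ≡⟨ xorSum-cong (suc N) (λ i i<1+N →
           trans (cong (λ k → P i ∧ xorSum k Q) (+-∸-assoc 1 (m<1+n⇒m≤n i<1+N)))
                 (∧-distribˡ-xor (P i) (xorSum (N ∸ i) Q) (Q (N ∸ i)))) ⟩
    xorSum (suc N) (λ i → (P i ∧ xorSum (N ∸ i) Q) xor (P i ∧ Q (N ∸ i)))
      ≡⟨ xorSum-xor (suc N) (λ i → P i ∧ xorSum (N ∸ i) Q) (λ i → P i ∧ Q (N ∸ i)) ⟩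
    (old xor (P N ∧ xorSum (N ∸ N) Q)) xor new
      ≡⟨ cong (λ k → (old xor (P N ∧ xorSum k Q)) xor new) (n∸n≡0 N) ⟩
    (old xor (P N ∧ false)) xor new
      ≡⟨ cong (λ x → (old xor x) xor new) (∧-zeroʳ (P N)) ⟩
    (old xor false) xor new
      ≡⟨ cong (_xor new) (xor-identityʳ old) ⟩
    old xor new ∎
    where open ≡-Reasoning

xorSum-cauchy : ∀ N {n₁ n₂} (P Q : ℕ → Bool) →
  (∀ i → n₁ ≤ i → P i ≡ false) → (∀ j → n₂ ≤ j → Q j ≡ false) → n₁ + n₂ ≤ suc N →
  xorSum N (λ a → xorSum (suc a) (λ i → P i ∧ Q (a ∸ i))) ≡ xorSum N P ∧ xorSum N Q
xorSum-cauchy N {n₁} {n₂} P Q P₀ Q₀ n₁+n₂≤1+N =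
  trans (xorSum-triangle N P Q) (trans (xorSum-cong N full-row) (xorSum-∧ʳ N (xorSum N Q) P))
  where
  -- every row with P i ≠ 0 already contains the whole support of Q
  full-row : ∀ i → i < N → P i ∧ xorSum (N ∸ i) Q ≡ P i ∧ xorSum N Q
  full-row i _ with n₁ ≤? i
  ... | yes n₁≤i = trans (cong (λ x → x ∧ xorSum (N ∸ i) Q) (P₀ i n₁≤i))
                         (sym (cong (λ x → x ∧ xorSum N Q) (P₀ i n₁≤i)))
  ... | no n₁≰i = cong (P i ∧_) (trans (xorSum-trunc n₂ (N ∸ i) Q₀ n₂≤N∸i)
                                       (sym (xorSum-trunc n₂ N Q₀ (≤-trans n₂≤N∸i (m∸n≤m N i)))))
    where
    n₂≤N∸i : n₂ ≤ N ∸ i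
    n₂≤N∸i = m+n≤o⇒m≤o∸n n₂ (≡-subst (_≤ N) (+-comm i n₂)
               (s≤s⁻¹ (≤-trans (+-monoˡ-≤ n₂ (≰⇒> n₁≰i)) n₁+n₂≤1+N)))

xorList-++ : ∀ xs ys → xorList (xs ++ ys) ≡ xorList xs xor xorList ys
xorList-++ []       ys = refl
xorList-++ (x ∷ xs) ys = trans (cong (x xor_) (xorList-++ xs ys)) (sym (xor-assoc x (xorList xs) (xorList ys)))

xorList-false : ∀ {A : Set} (h : A → Bool) (l : List A) → (∀ x → h x ≡ false) → xorList (map h l) ≡ false
xorList-false h []      h₀ = refl
xorList-false h (x ∷ l) h₀ = cong₂ _xor_ (h₀ x) (xorList-false h l h₀)

xorList-applyUpTo : ∀ {A : Set} (h : A → Bool) (f : ℕ → A) n →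
  xorList (map h (applyUpTo f n)) ≡ xorSum n (h ∘ f)
xorList-applyUpTo h f zero    = refl
xorList-applyUpTo h f (suc n) = begin
  xorList (map h (applyUpTo f (suc n)))        ≡⟨ cong (xorList ∘ map h) (sym (applyUpTo-∷ʳ f n)) ⟩
  xorList (map h (applyUpTo f n ∷ʳ f n))       ≡⟨ cong xorList (map-++ h (applyUpTo f n) (f n ∷ [])) ⟩
  xorList (map h (applyUpTo f n) ++ h (f n) ∷ []) ≡⟨ xorList-++ (map h (applyUpTo f n)) (h (f n) ∷ []) ⟩
  xorList (map h (applyUpTo f n)) xor (h (f n) xor false)
    ≡⟨ cong₂ _xor_ (xorList-applyUpTo h f n) (xor-identityʳ (h (f n))) ⟩
  xorSum (suc n) (h ∘ f) ∎
  where open ≡-Reasoning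

xorList-concatMap : ∀ {A B : Set} (h : B → Bool) (g : A → List B) (l : List A) →
  xorList (map h (concatMap g l)) ≡ xorList (map (λ x → xorList (map h (g x))) l)
xorList-concatMap h g []      = refl
xorList-concatMap h g (x ∷ l) =
  trans (cong xorList (map-++ h (g x) (concatMap g l)))
        (trans (xorList-++ (map h (g x)) (map h (concatMap g l)))
               (cong (xorList (map h (g x)) xor_) (xorList-concatMap h g l)))

Coeffs : Set
Coeffs = Monomial → Bool

infixl 7 _⋆_
_⋆_ : Coeffs → Coeffs → Coeffs
(c ⋆ d) m = xorList (map (λ uv → c (proj₁ uv) ∧ d (proj₂ uv)) (splits m))

⋆-cons : ∀ (c d : Coeffs) a m →
  (c ⋆ d) (a ∷ m) ≡ xorSum (suc a) (λ i → ((c ∘ (i ∷_)) ⋆ (d ∘ ((a ∸ i) ∷_))) m)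
⋆-cons c d a m =
  trans (xorList-concatMap term slice (upTo (suc a)))
        (trans (xorList-applyUpTo (λ i → xorList (map term (slice i))) id (suc a))
               (xorSum-cong (suc a) (λ i _ → cong xorList (sym (map-∘ (splits m))))))
  where
  term : Monomial × Monomial → Bool
  term uv = c (proj₁ uv) ∧ d (proj₂ uv)
  slice : ℕ → List (Monomial × Monomial)
  slice i = map (λ uv → (i ∷ proj₁ uv , (a ∸ i) ∷ proj₂ uv)) (splits m)

⋆-nil : ∀ (c d : Coeffs) → (c ⋆ d) [] ≡ c [] ∧ d []
⋆-nil c d = xor-identityʳ (c [] ∧ d [])

Vanishes : Coeffs → Set
Vanishes c = ∀ m → c m ≡ false

⋆-vanishesˡ : ∀ {c} d → Vanishes c → Vanishes (c ⋆ d)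
⋆-vanishesˡ {c} d c₀ m = xorList-false _ (splits m) (λ uv → cong (_∧ d (proj₂ uv)) (c₀ (proj₁ uv)))

⋆-vanishesʳ : ∀ c {d} → Vanishes d → Vanishes (c ⋆ d)
⋆-vanishesʳ c {d} d₀ m =
  xorList-false _ (splits m) (λ uv → trans (cong (c (proj₁ uv) ∧_) (d₀ (proj₂ uv))) (∧-zeroʳ _))

DegreeBounded : ℕ → Coeffs → Set
DegreeBounded D c = ∀ m → Any (D <_) m → c m ≡ false

degreeBounded-mono : ∀ {D D′ c} → D ≤ D′ → DegreeBounded D c → DegreeBounded D′ c
degreeBounded-mono D≤D′ bc m big = bc m (Any.map (≤-<-trans D≤D′) big)

degreeBounded-xor : ∀ {D c d} → DegreeBounded D c → DegreeBounded D d → DegreeBounded D (λ m → c m xor d m)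
degreeBounded-xor bc bd m big = cong₂ _xor_ (bc m big) (bd m big)

degreeBounded-scale : ∀ {D c} b → DegreeBounded D c → DegreeBounded D (λ m → b ∧ c m)
degreeBounded-scale b bc m big = trans (cong (b ∧_) (bc m big)) (∧-zeroʳ b)

degreeBounded-⋆ : ∀ {D₁ D₂ c d} → DegreeBounded D₁ c → DegreeBounded D₂ d → DegreeBounded (D₁ + D₂) (c ⋆ d)
degreeBounded-⋆ {D₁} {D₂} {c} {d} bc bd (a ∷ m) (here D₁+D₂<a) =
  trans (⋆-cons c d a m) (xorSum-false (suc a) slice₀)
  where
  slice₀ : ∀ i → i < suc a → ((c ∘ (i ∷_)) ⋆ (d ∘ ((a ∸ i) ∷_))) m ≡ false
  slice₀ i _ with i ≤? D₁
  ... | yes i≤D₁ = ⋆-vanishesʳ _ (λ v → bd ((a ∸ i) ∷ v) (here D₂<a∸i)) m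
    where
    D₂<a∸i : D₂ < a ∸ i
    D₂<a∸i = m+n≤o⇒m≤o∸n (suc D₂) (≡-subst (_≤ a) (cong suc (+-comm i D₂))
               (≤-<-trans (+-monoˡ-≤ D₂ i≤D₁) D₁+D₂<a))
  ... | no i≰D₁ = ⋆-vanishesˡ _ (λ u → bc (i ∷ u) (here (≰⇒> i≰D₁))) m
degreeBounded-⋆ {c = c} {d} bc bd (a ∷ m) (there big) =
  trans (⋆-cons c d a m)
        (xorSum-false (suc a) (λ i _ →
           degreeBounded-⋆ (λ u → bc (i ∷ u) ∘ there) (λ v → bd ((a ∸ i) ∷ v) ∘ there) m big))

_^ᵇ_ : Bool → ℕ → Bool
t ^ᵇ zero  = true
t ^ᵇ suc _ = t

^ᵇ-split : ∀ t i a → i ≤ a → t ^ᵇ a ≡ t ^ᵇ i ∧ t ^ᵇ (a ∸ i)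
^ᵇ-split t     zero    a       i≤a       = refl
^ᵇ-split false (suc i) (suc a) i≤a       = refl
^ᵇ-split true  (suc i) (suc a) (s≤s i≤a) = sym (true-power (a ∸ i))
  where
  true-power : ∀ n → true ^ᵇ n ≡ true
  true-power zero    = refl
  true-power (suc n) = refl

-- The box sum Σ_{m ∈ [0,D]^K} c m · ρ^m evaluates the coefficient function c
-- at ρ, provided c lives in the box.
boxSum : ℕ → ℕ → (ℕ → Bool) → Coeffs → Bool
boxSum zero    D ρ c = c []
boxSum (suc K) D ρ c = xorSum (suc D) (λ a → ρ 0 ^ᵇ a ∧ boxSum K D (ρ ∘ suc) (c ∘ (a ∷_)))

boxSum-cong : ∀ K D ρ {c c′ : Coeffs} → (∀ m → c m ≡ c′ m) → boxSum K D ρ c ≡ boxSum K D ρ c′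
boxSum-cong zero    D ρ eq = eq []
boxSum-cong (suc K) D ρ eq =
  xorSum-cong (suc D) (λ a _ → cong (ρ 0 ^ᵇ a ∧_) (boxSum-cong K D (ρ ∘ suc) (eq ∘ (a ∷_))))

boxSum-xor : ∀ K D ρ (c c′ : Coeffs) → boxSum K D ρ (λ m → c m xor c′ m) ≡ boxSum K D ρ c xor boxSum K D ρ c′
boxSum-xor zero    D ρ c c′ = refl
boxSum-xor (suc K) D ρ c c′ =
  trans (xorSum-cong (suc D) (λ a _ →
           trans (cong (ρ 0 ^ᵇ a ∧_) (boxSum-xor K D (ρ ∘ suc) (c ∘ (a ∷_)) (c′ ∘ (a ∷_))))
                 (∧-distribˡ-xor (ρ 0 ^ᵇ a) _ _)))
        (xorSum-xor (suc D) _ _)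

boxSum-scale : ∀ K D ρ b (c : Coeffs) → boxSum K D ρ (λ m → b ∧ c m) ≡ b ∧ boxSum K D ρ c
boxSum-scale zero    D ρ b c = refl
boxSum-scale (suc K) D ρ b c =
  trans (xorSum-cong (suc D) (λ a _ →
           trans (cong (ρ 0 ^ᵇ a ∧_) (boxSum-scale K D (ρ ∘ suc) b (c ∘ (a ∷_))))
                 (∧-swapˡ (ρ 0 ^ᵇ a) b _)))
        (xorSum-∧ˡ (suc D) b _)

boxSum-vanishes : ∀ K D ρ {c} → Vanishes c → boxSum K D ρ c ≡ false
boxSum-vanishes K D ρ {c} c₀ = trans (boxSum-cong K D ρ c₀) (boxSum-scale K D ρ false c)

boxSum-xorSum : ∀ K D ρ n (h : ℕ → Coeffs) →
  boxSum K D ρ (λ m → xorSum n (λ i → h i m)) ≡ xorSum n (λ i → boxSum K D ρ (h i))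
boxSum-xorSum K D ρ zero    h = boxSum-vanishes K D ρ (λ m → refl)
boxSum-xorSum K D ρ (suc n) h =
  trans (boxSum-xor K D ρ (λ m → xorSum n (λ i → h i m)) (h n))
        (cong (_xor boxSum K D ρ (h n)) (boxSum-xorSum K D ρ n h))

-- Evaluation at ρ is multiplicative on coefficient functions of bounded
-- individual degree: this is the heart of "equal polynomials have equal values".
boxSum-⋆ : ∀ K {D₁ D₂ D} ρ {c d} → D₁ + D₂ ≤ D → DegreeBounded D₁ c → DegreeBounded D₂ d →
  boxSum K D ρ (c ⋆ d) ≡ boxSum K D₁ ρ c ∧ boxSum K D₂ ρ d
boxSum-⋆ zero    ρ {c} {d} _ _ _ = ⋆-nil c d
boxSum-⋆ (suc K) {D₁} {D₂} {D} ρ {c} {d} D₁+D₂≤D bc bd = begin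
  xorSum (suc D) (λ a → t ^ᵇ a ∧ boxSum K D ρ′ ((c ⋆ d) ∘ (a ∷_)))
    ≡⟨ xorSum-cong (suc D) (λ a _ → convolution a) ⟩
  xorSum (suc D) (λ a → xorSum (suc a) (λ i → A i ∧ B (a ∸ i)))
    ≡⟨ xorSum-cauchy (suc D) A B A₀ B₀ (s≤s (≡-subst (_≤ suc D) (sym (+-suc D₁ D₂)) (s≤s D₁+D₂≤D))) ⟩
  xorSum (suc D) A ∧ xorSum (suc D) B
    ≡⟨ cong₂ _∧_ (xorSum-trunc (suc D₁) (suc D) A₀ (s≤s (m+n≤o⇒m≤o D₁ D₁+D₂≤D)))
                 (xorSum-trunc (suc D₂) (suc D) B₀ (s≤s (m+n≤o⇒n≤o D₁ D₁+D₂≤D))) ⟩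
  xorSum (suc D₁) A ∧ xorSum (suc D₂) B ∎
  where
  open ≡-Reasoning
  t  = ρ 0
  ρ′ = ρ ∘ suc
  A B : ℕ → Bool
  A i = t ^ᵇ i ∧ boxSum K D₁ ρ′ (c ∘ (i ∷_))
  B j = t ^ᵇ j ∧ boxSum K D₂ ρ′ (d ∘ (j ∷_))
  A₀ : ∀ i → suc D₁ ≤ i → A i ≡ false
  A₀ i D₁<i = trans (cong (t ^ᵇ i ∧_) (boxSum-vanishes K D₁ ρ′ (λ u → bc (i ∷ u) (here D₁<i)))) (∧-zeroʳ _)
  B₀ : ∀ j → suc D₂ ≤ j → B j ≡ false
  B₀ j D₂<j = trans (cong (t ^ᵇ j ∧_) (boxSum-vanishes K D₂ ρ′ (λ v → bd (j ∷ v) (here D₂<j)))) (∧-zeroʳ _)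
  convolution : ∀ a → t ^ᵇ a ∧ boxSum K D ρ′ ((c ⋆ d) ∘ (a ∷_)) ≡ xorSum (suc a) (λ i → A i ∧ B (a ∸ i))
  convolution a = begin
    t ^ᵇ a ∧ boxSum K D ρ′ ((c ⋆ d) ∘ (a ∷_))
      ≡⟨ cong (t ^ᵇ a ∧_) (trans (boxSum-cong K D ρ′ (⋆-cons c d a)) (boxSum-xorSum K D ρ′ (suc a) _)) ⟩
    t ^ᵇ a ∧ xorSum (suc a) (λ i → boxSum K D ρ′ ((c ∘ (i ∷_)) ⋆ (d ∘ ((a ∸ i) ∷_))))
      ≡⟨ sym (xorSum-∧ˡ (suc a) (t ^ᵇ a) _) ⟩
    xorSum (suc a) (λ i → t ^ᵇ a ∧ boxSum K D ρ′ ((c ∘ (i ∷_)) ⋆ (d ∘ ((a ∸ i) ∷_))))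
      ≡⟨ xorSum-cong (suc a) (λ i i≤a → cong₂ _∧_ (^ᵇ-split t i a (m<1+n⇒m≤n i≤a))
            (boxSum-⋆ K ρ′ D₁+D₂≤D (λ u → bc (i ∷ u) ∘ there) (λ v → bd ((a ∸ i) ∷ v) ∘ there))) ⟩
    xorSum (suc a) (λ i → (t ^ᵇ i ∧ t ^ᵇ (a ∸ i))
                          ∧ (boxSum K D₁ ρ′ (c ∘ (i ∷_)) ∧ boxSum K D₂ ρ′ (d ∘ ((a ∸ i) ∷_))))
      ≡⟨ xorSum-cong (suc a) (λ i _ → ∧-interchange (t ^ᵇ i) (t ^ᵇ (a ∸ i)) _ _) ⟩
    xorSum (suc a) (λ i → A i ∧ B (a ∸ i)) ∎

-- c = x₀^k · r: the coefficient of x₀^a · m in c is [a = k] · r m.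
-- Both allZero (k = 0) and isVarMono i (k = 0 or 1) have this shape.
HeadPower : ℕ → Coeffs → Coeffs → Set
HeadPower k r c = ∀ a m → c (a ∷ m) ≡ (a ≡ᵇ k) ∧ r m

degreeBounded-headPower : ∀ {k D r c} → HeadPower k r c → k ≤ D → DegreeBounded D r → DegreeBounded D c
degreeBounded-headPower {k} {r = r} hp k≤D br (a ∷ m) (here D<a) =
  trans (hp a m) (cong (_∧ r m) (≢⇒≡ᵇ-false a k (>⇒≢ (≤-<-trans k≤D D<a))))
degreeBounded-headPower {k} hp k≤D br (a ∷ m) (there big) =
  trans (hp a m) (trans (cong ((a ≡ᵇ k) ∧_) (br m big)) (∧-zeroʳ _))

boxSum-headPower : ∀ K D ρ {k r c} → HeadPower k r c → k ≤ D →
  boxSum (suc K) D ρ c ≡ ρ 0 ^ᵇ k ∧ boxSum K D (ρ ∘ suc) r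
boxSum-headPower K D ρ {k} {r} hp k≤D =
  trans (xorSum-cong (suc D) (λ a _ →
           trans (cong (ρ 0 ^ᵇ a ∧_) (trans (boxSum-cong K D (ρ ∘ suc) (hp a))
                                            (boxSum-scale K D (ρ ∘ suc) (a ≡ᵇ k) r)))
                 (∧-swapˡ (ρ 0 ^ᵇ a) (a ≡ᵇ k) _)))
        (xorSum-δ (suc D) k (λ a → ρ 0 ^ᵇ a ∧ boxSum K D (ρ ∘ suc) r) (s≤s k≤D))

degreeBounded-allZero : DegreeBounded 0 allZero
degreeBounded-allZero (a ∷ m) (here 0<a)  = cong (_∧ allZero m) (≢⇒≡ᵇ-false a 0 (>⇒≢ 0<a))
degreeBounded-allZero (a ∷ m) (there big) =
  trans (cong ((a ≡ᵇ 0) ∧_) (degreeBounded-allZero m big)) (∧-zeroʳ _)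

degreeBounded-isVarMono : ∀ i → DegreeBounded 1 (isVarMono i)
degreeBounded-isVarMono zero    =
  degreeBounded-headPower {c = isVarMono 0} (λ a m → refl) ≤-refl (degreeBounded-mono z≤n degreeBounded-allZero)
degreeBounded-isVarMono (suc i) =
  degreeBounded-headPower {c = isVarMono (suc i)} (λ a m → refl) z≤n (degreeBounded-isVarMono i)

boxSum-allZero : ∀ K D ρ → boxSum K D ρ allZero ≡ true
boxSum-allZero zero    D ρ = refl
boxSum-allZero (suc K) D ρ =
  trans (boxSum-headPower K D ρ {c = allZero} (λ a m → refl) z≤n) (boxSum-allZero K D (ρ ∘ suc))

boxSum-isVarMono : ∀ K D ρ i → i < K → 1 ≤ D → boxSum K D ρ (isVarMono i) ≡ ρ i
boxSum-isVarMono (suc K) D ρ zero    _ 1≤D =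
  trans (boxSum-headPower K D ρ {c = isVarMono 0} (λ a m → refl) 1≤D)
        (trans (cong (ρ 0 ∧_) (boxSum-allZero K D (ρ ∘ suc))) (∧-identityʳ (ρ 0)))
boxSum-isVarMono (suc K) D ρ (suc i) (s≤s i<K) 1≤D =
  trans (boxSum-headPower K D ρ {c = isVarMono (suc i)} (λ a m → refl) z≤n)
        (boxSum-isVarMono K D (ρ ∘ suc) i i<K 1≤D)

eval : (ℕ → Bool) → Expr → Bool
eval ρ (var i)   = ρ i
eval ρ (const c) = c
eval ρ (e ⊕ f)   = eval ρ e xor eval ρ f
eval ρ (e ⊗ f)   = eval ρ e ∧ eval ρ f

varBound : Expr → ℕ
varBound (var i)   = suc i
varBound (const _) = 0
varBound (e ⊕ f)   = varBound e + varBound f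
varBound (e ⊗ f)   = varBound e + varBound f

degBound : Expr → ℕ
degBound (var _)   = 1
degBound (const _) = 0
degBound (e ⊕ f)   = degBound e + degBound f
degBound (e ⊗ f)   = degBound e + degBound f

degreeBounded-coeff : ∀ e → DegreeBounded (degBound e) (coeff e)
degreeBounded-coeff (var i)   = degreeBounded-isVarMono i
degreeBounded-coeff (const c) = degreeBounded-scale c degreeBounded-allZero
degreeBounded-coeff (e ⊕ f)   =
  degreeBounded-xor (degreeBounded-mono (m≤m+n (degBound e) (degBound f)) (degreeBounded-coeff e))
                    (degreeBounded-mono (m≤n+m (degBound f) (degBound e)) (degreeBounded-coeff f))
degreeBounded-coeff (e ⊗ f)   = degreeBounded-⋆ (degreeBounded-coeff e) (degreeBounded-coeff f)

eval-boxSum : ∀ e K D ρ → varBound e ≤ K → degBound e ≤ D → eval ρ e ≡ boxSum K D ρ (coeff e)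
eval-boxSum (var i)   K D ρ i<K 1≤D = sym (boxSum-isVarMono K D ρ i i<K 1≤D)
eval-boxSum (const c) K D ρ _   _   =
  sym (trans (boxSum-scale K D ρ c allZero) (trans (cong (c ∧_) (boxSum-allZero K D ρ)) (∧-identityʳ c)))
eval-boxSum (e ⊕ f)   K D ρ v≤K d≤D =
  trans (cong₂ _xor_ (eval-boxSum e K D ρ (m+n≤o⇒m≤o (varBound e) v≤K) (m+n≤o⇒m≤o (degBound e) d≤D))
                     (eval-boxSum f K D ρ (m+n≤o⇒n≤o (varBound e) v≤K) (m+n≤o⇒n≤o (degBound e) d≤D)))
        (sym (boxSum-xor K D ρ (coeff e) (coeff f)))
eval-boxSum (e ⊗ f)   K D ρ v≤K d≤D =
  trans (cong₂ _∧_ (eval-boxSum e K (degBound e) ρ (m+n≤o⇒m≤o (varBound e) v≤K) ≤-refl)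
                   (eval-boxSum f K (degBound f) ρ (m+n≤o⇒n≤o (varBound e) v≤K) ≤-refl))
        (sym (boxSum-⋆ K ρ d≤D (degreeBounded-coeff e) (degreeBounded-coeff f)))

eval-≈ : ∀ {e e′} → e ≈ e′ → ∀ ρ → eval ρ e ≡ eval ρ e′
eval-≈ {e} {e′} e≈e′ ρ =
  trans (eval-boxSum e K D ρ (m≤m+n _ _) (m≤m+n _ _))
        (trans (boxSum-cong K D ρ e≈e′) (sym (eval-boxSum e′ K D ρ (m≤n+m _ _) (m≤n+m _ _))))
  where
  K = varBound e + varBound e′
  D = degBound e + degBound e′

-- Over F₂ only the parity of the multiplicity of a variable in an affine
-- form matters: parity j vs is the number of occurrences of j in vs mod 2.
parity : ℕ → List ℕ → Bool
parity j []       = false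
parity j (v ∷ vs) = (j ≡ᵇ v) xor parity j vs

xorList-parity : ∀ K (h : ℕ → Bool) vs → All (_< K) vs →
  xorList (map h vs) ≡ xorSum K (λ j → parity j vs ∧ h j)
xorList-parity K h []       []           = sym (xorSum-false K (λ j _ → refl))
xorList-parity K h (v ∷ vs) (v<K ∷ vs<K) = sym (begin
  xorSum K (λ j → ((j ≡ᵇ v) xor parity j vs) ∧ h j)
    ≡⟨ xorSum-cong K (λ j _ → ∧-distribʳ-xor (h j) (j ≡ᵇ v) (parity j vs)) ⟩
  xorSum K (λ j → ((j ≡ᵇ v) ∧ h j) xor (parity j vs ∧ h j))
    ≡⟨ xorSum-xor K (λ j → (j ≡ᵇ v) ∧ h j) (λ j → parity j vs ∧ h j) ⟩
  xorSum K (λ j → (j ≡ᵇ v) ∧ h j) xor xorSum K (λ j → parity j vs ∧ h j)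
    ≡⟨ cong₂ _xor_ (xorSum-δ K v h v<K) (sym (xorList-parity K h vs vs<K)) ⟩
  h v xor xorList (map h vs) ∎)
  where open ≡-Reasoning

addVars : ℕ → (ℕ → Bool) → Expr → Expr
addVars zero    p e = e
addVars (suc K) p e = if p K then addVars K p e ⊕ var K else addVars K p e

coeff-addVars : ∀ K p e m → coeff (addVars K p e) m ≡ coeff e m xor xorSum K (λ j → p j ∧ isVarMono j m)
coeff-addVars zero    p e m = sym (xor-identityʳ (coeff e m))
coeff-addVars (suc K) p e m with p K
... | true  = trans (cong (_xor isVarMono K m) (coeff-addVars K p e m))
                    (xor-assoc (coeff e m) (xorSum K (λ j → p j ∧ isVarMono j m)) (isVarMono K m))
... | false = trans (coeff-addVars K p e m)
                    (cong (coeff e m xor_) (sym (xor-identityʳ (xorSum K (λ j → p j ∧ isVarMono j m)))))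

size-addVars : ∀ K p e → size (addVars K p e) ≤ size e + 2 * K
size-addVars zero    p e = ≤-reflexive (sym (+-identityʳ (size e)))
size-addVars (suc K) p e with p K
... | true  = ≤-trans (s≤s (+-monoˡ-≤ 1 (size-addVars K p e)))
                      (≤-reflexive (solve 2 (λ x k → con 1 :+ ((x :+ con 2 :* k) :+ con 1)
                                                   := x :+ con 2 :* (con 1 :+ k)) refl (size e) K))
  where open +-*-Solver
... | false = ≤-trans (size-addVars K p e) (+-monoʳ-≤ (size e) (*-monoʳ-≤ 2 (n≤1+n K)))

varsBelow-addVars : ∀ K k p e → K ≤ k → VarsBelow k e → VarsBelow k (addVars K p e)
varsBelow-addVars zero    k p e K≤k e<k = e<k
varsBelow-addVars (suc K) k p e K<k e<k with p K
... | true  = varsBelow-addVars K k p e (<⇒≤ K<k) e<k , K<k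
... | false = varsBelow-addVars K k p e (<⇒≤ K<k) e<k

coeff-affineExpr : ∀ c vs m →
  coeff (affineExpr (c , vs)) m ≡ (c ∧ allZero m) xor xorList (map (λ i → isVarMono i m) vs)
coeff-affineExpr c []       m = sym (xor-identityʳ (c ∧ allZero m))
coeff-affineExpr c (v ∷ vs) m =
  trans (cong (isVarMono v m xor_) (coeff-affineExpr c vs m))
        (xor-swapˡ (isVarMono v m) (c ∧ allZero m) (xorList (map (λ i → isVarMono i m) vs)))

normalForm : ℕ → Affine → Expr
normalForm K (c , vs) = addVars K (λ j → parity j vs) (const c)

normalForm-≈ : ∀ K l → AffineVarsBelow K l → normalForm K l ≈ affineExpr l
normalForm-≈ K (c , vs) vs<K m = begin
  coeff (normalForm K (c , vs)) m
    ≡⟨ coeff-addVars K (λ j → parity j vs) (const c) m ⟩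
  (c ∧ allZero m) xor xorSum K (λ j → parity j vs ∧ isVarMono j m)
    ≡⟨ cong ((c ∧ allZero m) xor_) (sym (xorList-parity K (λ j → isVarMono j m) vs vs<K)) ⟩
  (c ∧ allZero m) xor xorList (map (λ i → isVarMono i m) vs)
    ≡⟨ sym (coeff-affineExpr c vs m) ⟩
  coeff (affineExpr (c , vs)) m ∎
  where open ≡-Reasoning

≈-trans : ∀ {e f g} → e ≈ f → f ≈ g → e ≈ g
≈-trans e≈f f≈g m = trans (e≈f m) (f≈g m)

⊗-cong : ∀ {e e′ f f′} → e ≈ e′ → f ≈ f′ → e ⊗ f ≈ e′ ⊗ f′
⊗-cong e≈e′ f≈f′ m = cong xorList (map-cong (λ uv → cong₂ _∧_ (e≈e′ (proj₁ uv)) (f≈f′ (proj₂ uv))) (splits m))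

prodExpr-cong : ∀ {A : Set} {P : A → Set} (f g : A → Expr) → (∀ {x} → P x → f x ≈ g x) →
  ∀ {L} → All P L → prodExpr (map f L) ≈ prodExpr (map g L)
prodExpr-cong f g f≈g []         m = refl
prodExpr-cong f g f≈g {x ∷ xs} (px ∷ pxs) =
  ⊗-cong {f x} {g x} {prodExpr (map f xs)} {prodExpr (map g xs)} (f≈g px) (prodExpr-cong f g f≈g pxs)

size-prodExpr : ∀ {k} → 1 ≤ k → ∀ {es} → All (λ e → size e < k) es → size (prodExpr es) ≤ suc (length es) * k
size-prodExpr {k} 1≤k []       = ≤-trans 1≤k (≤-reflexive (sym (+-identityʳ k)))
size-prodExpr     1≤k (e<k ∷ es<k) = +-mono-≤ e<k (size-prodExpr 1≤k es<k)

varsBelow-prodExpr : ∀ {k es} → All (VarsBelow k) es → VarsBelow k (prodExpr es)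
varsBelow-prodExpr []           = tt
varsBelow-prodExpr (e<k ∷ es<k) = e<k , varsBelow-prodExpr es<k

^-bound : ∀ n {k C} → k ≤ C → n ^ k ≤ suc (n ^ C)
^-bound zero    {zero}  k≤C = s≤s z≤n
^-bound zero    {suc k} k≤C = z≤n
^-bound (suc n)         k≤C = ≤-trans (^-monoʳ-≤ (suc n) k≤C) (n≤1+n _)

square-^-bound : ∀ n {c C} → c + c ≤ C → suc (n ^ c) * suc (n ^ c) ≤ 4 * suc (n ^ C)
square-^-bound n {c} {C} c+c≤C = begin
  suc X * suc X             ≡⟨ solve 1 (λ X → (con 1 :+ X) :* (con 1 :+ X) := X :* X :+ con 2 :* X :+ con 1) refl X ⟩
  X * X + 2 * X + 1         ≤⟨ +-mono-≤ (+-mono-≤ X*X≤ (*-monoʳ-≤ 2 X≤)) (s≤s z≤n) ⟩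
  suc Y + 2 * suc Y + suc Y ≡⟨ solve 1 (λ Y → (con 1 :+ Y) :+ con 2 :* (con 1 :+ Y) :+ (con 1 :+ Y)
                                           := con 4 :* (con 1 :+ Y)) refl Y ⟩
  4 * suc Y ∎
  where
  open ≤-Reasoning
  open +-*-Solver
  X = n ^ c
  Y = n ^ C
  X≤ : X ≤ suc Y
  X≤ = ^-bound n (≤-trans (m≤m+n c c) c+c≤C)
  X*X≤ : X * X ≤ suc Y
  X*X≤ = ≤-trans (≤-reflexive (sym (^-distribˡ-+-* n c c))) (^-bound n c+c≤C)

-- Polynomially bounded functions are closed under s ↦ (s + 1)(2s + 2):
-- if s n ≤ c n^c + c then (s n + 1)(2 s n + 2) ≤ 2 (c+1)² (n^c + 1)² ≤ C n^C + C
-- for C = 8 (c+1)².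
polyBounded-quadratic : ∀ {s} → PolyBounded s → PolyBounded (λ n → suc (s n) * (2 + 2 * s n))
polyBounded-quadratic {s} (c , s≤) = C , bound
  where
  open +-*-Solver
  C = 8 * (suc c * suc c)
  c+c≤C : c + c ≤ C
  c+c≤C = ≤-trans (m≤m+n (c + c) (8 * (c * c) + 14 * c + 8))
            (≤-reflexive (solve 1 (λ c → (c :+ c) :+ (con 8 :* (c :* c) :+ con 14 :* c :+ con 8)
                                      := con 8 :* ((con 1 :+ c) :* (con 1 :+ c))) refl c))
  bound : ∀ n → suc (s n) * (2 + 2 * s n) ≤ C * n ^ C + C
  bound n = begin
    suc (s n) * (2 + 2 * s n)
      ≡⟨ solve 1 (λ x → (con 1 :+ x) :* (con 2 :+ con 2 :* x) := con 2 :* ((con 1 :+ x) :* (con 1 :+ x)))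
                 refl (s n) ⟩
    2 * (suc (s n) * suc (s n))
      ≤⟨ *-monoʳ-≤ 2 (*-mono-≤ 1+s≤ 1+s≤) ⟩
    2 * ((suc c * suc X) * (suc c * suc X))
      ≡⟨ solve 2 (λ c X → con 2 :* (((con 1 :+ c) :* (con 1 :+ X)) :* ((con 1 :+ c) :* (con 1 :+ X)))
                      := con 2 :* ((con 1 :+ c) :* (con 1 :+ c)) :* ((con 1 :+ X) :* (con 1 :+ X))) refl c X ⟩
    2 * (suc c * suc c) * (suc X * suc X)
      ≤⟨ *-monoʳ-≤ (2 * (suc c * suc c)) (square-^-bound n {c} c+c≤C) ⟩
    2 * (suc c * suc c) * (4 * suc Y)
      ≡⟨ solve 2 (λ c Y → con 2 :* ((con 1 :+ c) :* (con 1 :+ c)) :* (con 4 :* (con 1 :+ Y))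
                      := con 8 :* ((con 1 :+ c) :* (con 1 :+ c)) :* Y :+ con 8 :* ((con 1 :+ c) :* (con 1 :+ c)))
                 refl c Y ⟩
    C * Y + C ∎
    where
    open ≤-Reasoning
    X = n ^ c
    Y = n ^ C
    1+s≤ : suc (s n) ≤ suc c * suc X
    1+s≤ = ≤-trans (s≤s (≤-trans (s≤ n) (m≤n+m (c * X + c) X)))
             (≤-reflexive (solve 2 (λ c X → con 1 :+ (X :+ (c :* X :+ c)) := (con 1 :+ c) :* (con 1 :+ X))
                                   refl c X))

-- Every product of polynomially many affine forms is a polynomial-size formula:
-- normalise each of the ≤ s n forms to size ≤ 2 s n + 1.
VP1⊆VPe : VP1 ⊆ᶜ VPe
VP1⊆VPe f (s , s-poly , products) =
  (λ n → suc (s n) * (2 + 2 * s n)) , polyBounded-quadratic s-poly , formula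
  where
  formula : ∀ n → ∃[ φ ] (size φ ≤ suc (s n) * (2 + 2 * s n) ×
                          VarsBelow (suc (s n) * (2 + 2 * s n)) φ × φ ≈ f n)
  formula n with products n
  ... | L , |L|≤s , L<s , L≈f =
    prodExpr (map (normalForm (s n)) L) ,
    ≤-trans (size-prodExpr (s≤s z≤n) (map⁺ (universal normalForm-small L)))
            (≤-trans (≤-reflexive (cong (λ r → suc r * (2 + 2 * s n)) (length-map (normalForm (s n)) L)))
                     (*-monoˡ-≤ (2 + 2 * s n) (s≤s |L|≤s))) ,
    varsBelow-prodExpr (map⁺ (universal normalForm-varsBelow L)) ,
    ≈-trans {prodExpr (map (normalForm (s n)) L)} {prodExpr (map affineExpr L)} {f n}
            (prodExpr-cong (normalForm (s n)) affineExpr (λ {l} → normalForm-≈ (s n) l) L<s) L≈f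
    where
    normalForm-small : ∀ l → size (normalForm (s n) l) < 2 + 2 * s n
    normalForm-small (c , vs) = s≤s (size-addVars (s n) (λ j → parity j vs) (const c))
    normalForm-varsBelow : ∀ l → VarsBelow (suc (s n) * (2 + 2 * s n)) (normalForm (s n) l)
    normalForm-varsBelow (c , vs) =
      varsBelow-addVars (s n) _ (λ j → parity j vs) (const c)
        (≤-trans (n≤1+n (s n)) (m≤m*n (suc (s n)) (2 + 2 * s n))) tt

VNP1⊆VNP : VNP1 ⊆ᶜ VNP
VNP1⊆VNP f (g , g∈VP1 , rest) = g , VP1⊆VPe g g∈VP1 , rest

record Sum₃ (ρ ρ₁ ρ₂ ρ₃ : ℕ → Bool) : Set where
  constructor sum₃
  field at : ∀ i → ρ i ≡ (ρ₁ i xor ρ₂ i) xor ρ₃ i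
open Sum₃

-- H (as an indicator) is closed under three-term sums; over F₂ these are
-- exactly the affine combinations, so the closed sets are the affine subspaces.
ThreeClosed : ((ℕ → Bool) → Bool) → Set
ThreeClosed H = ∀ {ρ ρ₁ ρ₂ ρ₃} → Sum₃ ρ ρ₁ ρ₂ ρ₃ → H ρ₁ ≡ true → H ρ₂ ≡ true → H ρ₃ ≡ true → H ρ ≡ true

threeClosed-ext : ∀ {H H′} → (∀ ρ → H ρ ≡ H′ ρ) → ThreeClosed H → ThreeClosed H′
threeClosed-ext H≡H′ closed ρ≡ h₁ h₂ h₃ =
  trans (sym (H≡H′ _)) (closed ρ≡ (trans (H≡H′ _) h₁) (trans (H≡H′ _) h₂) (trans (H≡H′ _) h₃))

sum₃-cancel : ∀ x u v → x ≡ (((x xor u) xor v) xor u) xor v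
sum₃-cancel false false false = refl
sum₃-cancel false false true  = refl
sum₃-cancel false true  false = refl
sum₃-cancel false true  true  = refl
sum₃-cancel true  false false = refl
sum₃-cancel true  false true  = refl
sum₃-cancel true  true  false = refl
sum₃-cancel true  true  true  = refl

bool-ext : ∀ {a b} → (a ≡ true → b ≡ true) → (b ≡ true → a ≡ true) → a ≡ b
bool-ext {false} {false} a⇒b b⇒a = refl
bool-ext {false} {true}  a⇒b b⇒a = b⇒a refl
bool-ext {true}  {false} a⇒b b⇒a = sym (a⇒b refl)
bool-ext {true}  {true}  a⇒b b⇒a = refl

threeClosed-shift : ∀ {H} → ThreeClosed H → ∀ {x y u v} → H u ≡ true → H v ≡ true → Sum₃ y x u v → H x ≡ H y
threeClosed-shift closed {x} {y} {u} {v} hu hv y≡ =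
  bool-ext (λ hx → closed y≡ hx hu hv)
           (λ hy → closed (sum₃ (λ i → trans (sum₃-cancel (x i) (u i) (v i))
                                             (cong (λ w → (w xor u i) xor v i) (sym (at y≡ i))))) hy hu hv)

-- Affine forms commute with three-term sums (their coefficients sum to 1).
affine-sum₃ : ∀ {ε ε₁ ε₂ ε₃} → Sum₃ ε ε₁ ε₂ ε₃ → ∀ l →
  eval ε (affineExpr l) ≡ (eval ε₁ (affineExpr l) xor eval ε₂ (affineExpr l)) xor eval ε₃ (affineExpr l)
affine-sum₃ ε≡ (false , [])    = refl
affine-sum₃ ε≡ (true  , [])    = refl
affine-sum₃ {ε} {ε₁} {ε₂} {ε₃} ε≡ (c , v ∷ vs) =
  trans (cong₂ _xor_ (at ε≡ v) (affine-sum₃ ε≡ (c , vs)))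
        (trans (xor-interchange (ε₁ v xor ε₂ v) (ε₃ v) (rest ε₁ xor rest ε₂) (rest ε₃))
               (cong (_xor (ε₃ v xor rest ε₃)) (xor-interchange (ε₁ v) (ε₂ v) (rest ε₁) (rest ε₂))))
  where
  rest : (ℕ → Bool) → Bool
  rest ε′ = eval ε′ (affineExpr (c , vs))

∧-true : ∀ {a b} → a ∧ b ≡ true → (a ≡ true) × (b ≡ true)
∧-true {true} {true} refl = refl , refl

affineProduct-threeClosed : ∀ L → ThreeClosed (λ ε → eval ε (prodExpr (map affineExpr L)))
affineProduct-threeClosed []      ε≡ h₁ h₂ h₃ = refl
affineProduct-threeClosed (l ∷ L) ε≡ h₁ h₂ h₃ with ∧-true h₁ | ∧-true h₂ | ∧-true h₃
... | l₁ , L₁ | l₂ , L₂ | l₃ , L₃ =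
  cong₂ _∧_ (trans (affine-sum₃ ε≡ l) (sum-of-ones l₁ l₂ l₃)) (affineProduct-threeClosed L ε≡ L₁ L₂ L₃)
  where
  sum-of-ones : ∀ {a b c} → a ≡ true → b ≡ true → c ≡ true → (a xor b) xor c ≡ true
  sum-of-ones refl refl refl = refl

infix 5 _▹_
_▹_ : List Bool → (ℕ → Bool) → ℕ → Bool
(b ▹ ρ) i = eval ρ (bitSub b i)

eval-subst : ∀ ρ σ e → eval ρ (subst σ e) ≡ eval (λ i → eval ρ (σ i)) e
eval-subst ρ σ (var i)   = refl
eval-subst ρ σ (const c) = refl
eval-subst ρ σ (e ⊕ f)   = cong₂ _xor_ (eval-subst ρ σ e) (eval-subst ρ σ f)
eval-subst ρ σ (e ⊗ f)   = cong₂ _∧_ (eval-subst ρ σ e) (eval-subst ρ σ f)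

cubeParity : ℕ → ((ℕ → Bool) → Bool) → (ℕ → Bool) → Bool
cubeParity P H ρ = xorList (map (λ b → H (b ▹ ρ)) (allBits P))

eval-cubeSum : ∀ P g ρ → eval ρ (cubeSum P g) ≡ cubeParity P (λ ε → eval ε g) ρ
eval-cubeSum P g ρ = go (allBits P)
  where
  go : ∀ bs → eval ρ (foldr (λ b acc → subst (bitSub b) g ⊕ acc) (const false) bs)
              ≡ xorList (map (λ b → eval (b ▹ ρ) g) bs)
  go []       = refl
  go (b ∷ bs) = cong₂ _xor_ (eval-subst ρ (bitSub b) g) (go bs)

infixl 6 _⊕ˡ_
_⊕ˡ_ : List Bool → List Bool → List Bool
_⊕ˡ_ = zipWith _xor_

length-⊕ˡ : ∀ {P} b y → length b ≡ P → length y ≡ P → length (b ⊕ˡ y) ≡ P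
length-⊕ˡ []      []      refl refl = refl
length-⊕ˡ (x ∷ b) (z ∷ y) refl eq   = cong suc (length-⊕ˡ b y refl (suc-injective eq))

Sum₃ˡ : List Bool → List Bool → List Bool → List Bool → Set
Sum₃ˡ []      []        []        []        = ⊤
Sum₃ˡ (x ∷ b) (x₁ ∷ b₁) (x₂ ∷ b₂) (x₃ ∷ b₃) = (x ≡ (x₁ xor x₂) xor x₃) × Sum₃ˡ b b₁ b₂ b₃
Sum₃ˡ _       _         _         _         = ⊥

sum₃ˡ-⊕ˡ : ∀ {P} b y z → length b ≡ P → length y ≡ P → length z ≡ P → Sum₃ˡ (b ⊕ˡ y ⊕ˡ z) b y z
sum₃ˡ-⊕ˡ []      []      []      refl refl refl = tt
sum₃ˡ-⊕ˡ (x ∷ b) (u ∷ y) (v ∷ z) refl ly   lz   =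
  refl , sum₃ˡ-⊕ˡ b y z refl (suc-injective ly) (suc-injective lz)

▹-sum₃ : ∀ b b₁ b₂ b₃ → Sum₃ˡ b b₁ b₂ b₃ → ∀ {ρ ρ₁ ρ₂ ρ₃} → Sum₃ ρ ρ₁ ρ₂ ρ₃ →
  Sum₃ (b ▹ ρ) (b₁ ▹ ρ₁) (b₂ ▹ ρ₂) (b₃ ▹ ρ₃)
▹-sum₃ []      []        []        []        tt       ρ≡ = ρ≡
▹-sum₃ (x ∷ b) (x₁ ∷ b₁) (x₂ ∷ b₂) (x₃ ∷ b₃) (x≡ , b≡) ρ≡ = sum₃ λ where
  zero    → x≡
  (suc i) → at (▹-sum₃ b b₁ b₂ b₃ b≡ ρ≡) i

allBits-length : ∀ P → All (λ b → length b ≡ P) (allBits P)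
allBits-length zero    = refl ∷ []
allBits-length (suc P) = ++⁺ (map⁺ (All.map (cong suc) (allBits-length P)))
                             (map⁺ (All.map (cong suc) (allBits-length P)))

xorList-allBits-suc : ∀ P (G : List Bool → Bool) → xorList (map G (allBits (suc P))) ≡
  xorList (map (G ∘ (false ∷_)) (allBits P)) xor xorList (map (G ∘ (true ∷_)) (allBits P))
xorList-allBits-suc P G =
  trans (cong xorList (map-++ G (map (false ∷_) (allBits P)) (map (true ∷_) (allBits P))))
        (trans (xorList-++ (map G (map (false ∷_) (allBits P))) (map G (map (true ∷_) (allBits P))))
               (cong₂ _xor_ (cong xorList (sym (map-∘ (allBits P)))) (cong xorList (sym (map-∘ (allBits P))))))

xorList-allBits-shift : ∀ P (F : List Bool → Bool) t → length t ≡ P →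
  xorList (map (λ b → F (b ⊕ˡ t)) (allBits P)) ≡ xorList (map F (allBits P))
xorList-allBits-shift zero    F []      refl = refl
xorList-allBits-shift (suc P) F (x ∷ t) lt   =
  trans (xorList-allBits-suc P (λ b → F (b ⊕ˡ (x ∷ t))))
        (trans (halves x) (sym (xorList-allBits-suc P F)))
  where
  half : ∀ y → xorList (map (λ b → F (y ∷ b ⊕ˡ t)) (allBits P)) ≡ xorList (map (F ∘ (y ∷_)) (allBits P))
  half y = xorList-allBits-shift P (F ∘ (y ∷_)) t (suc-injective lt)
  halves : ∀ x → xorList (map (λ b → F ((false xor x) ∷ b ⊕ˡ t)) (allBits P))
                   xor xorList (map (λ b → F ((true xor x) ∷ b ⊕ˡ t)) (allBits P))
                 ≡ xorList (map (F ∘ (false ∷_)) (allBits P)) xor xorList (map (F ∘ (true ∷_)) (allBits P))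
  halves false = cong₂ _xor_ (half false) (half true)
  halves true  = trans (cong₂ _xor_ (half true) (half false))
                       (xor-comm (xorList (map (F ∘ (true ∷_)) (allBits P))) _)

xorList-map-congᴬ : ∀ {Q : List Bool → Set} {bs} (h h′ : List Bool → Bool) → All Q bs →
  (∀ b → Q b → h b ≡ h′ b) → xorList (map h bs) ≡ xorList (map h′ bs)
xorList-map-congᴬ h h′ []       eq = refl
xorList-map-congᴬ h h′ (q ∷ qs) eq = cong₂ _xor_ (eq _ q) (xorList-map-congᴬ h h′ qs eq)

xorList-witness : ∀ {Q : List Bool → Set} {bs} (h : List Bool → Bool) → All Q bs →
  xorList (map h bs) ≡ true → ∃[ b ] (Q b × h b ≡ true)
xorList-witness {bs = b ∷ bs} h (q ∷ qs) odd with h b in hb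
... | true  = b , q , hb
... | false = xorList-witness h qs odd

-- Fibre parities of an affine subspace form a three-closed function: if the
-- fibres over ρ₁, ρ₂, ρ₃ have odd size, the fibre over ρ₁ + ρ₂ + ρ₃ is a
-- translate of the fibre over ρ₁.
cubeParity-threeClosed : ∀ {H} → ThreeClosed H → ∀ P → ThreeClosed (cubeParity P H)
cubeParity-threeClosed {H} closed P {ρ} {ρ₁} ρ≡ odd₁ odd₂ odd₃
  with xorList-witness _ (allBits-length P) odd₁
     | xorList-witness _ (allBits-length P) odd₂
     | xorList-witness _ (allBits-length P) odd₃
... | b₁ , l₁ , h₁ | b₂ , l₂ , h₂ | b₃ , l₃ , h₃ = begin
  cubeParity P H ρ
    ≡⟨ sym (xorList-allBits-shift P (λ b → H (b ▹ ρ)) c l-c) ⟩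
  xorList (map (λ b → H (b ⊕ˡ c ▹ ρ)) (allBits P))
    ≡⟨ sym (xorList-allBits-shift P (λ b → H (b ⊕ˡ c ▹ ρ)) b₁ l₁) ⟩
  xorList (map (λ b → H (b ⊕ˡ b₁ ⊕ˡ c ▹ ρ)) (allBits P))
    ≡⟨ sym (xorList-map-congᴬ _ _ (allBits-length P) translate) ⟩
  cubeParity P H ρ₁
    ≡⟨ odd₁ ⟩
  true ∎
  where
  open ≡-Reasoning
  c = b₁ ⊕ˡ b₂ ⊕ˡ b₃
  l-c : length c ≡ P
  l-c = length-⊕ˡ (b₁ ⊕ˡ b₂) b₃ (length-⊕ˡ b₁ b₂ l₁ l₂) l₃
  h-c : H (c ▹ ρ) ≡ true
  h-c = closed (▹-sum₃ c b₁ b₂ b₃ (sum₃ˡ-⊕ˡ b₁ b₂ b₃ l₁ l₂ l₃) ρ≡) h₁ h₂ h₃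
  ρ≡ρ₁+ρ₁+ρ : Sum₃ ρ ρ₁ ρ₁ ρ
  ρ≡ρ₁+ρ₁+ρ = sum₃ (λ i → sym (cong (_xor ρ i) (xor-same (ρ₁ i))))
  -- (b + b₁ + c, ρ) = (b, ρ₁) + (b₁, ρ₁) + (c, ρ), a shift by two points of H
  translate : ∀ b → length b ≡ P → H (b ▹ ρ₁) ≡ H (b ⊕ˡ b₁ ⊕ˡ c ▹ ρ)
  translate b l-b =
    threeClosed-shift closed h₁ h-c (▹-sum₃ (b ⊕ˡ b₁ ⊕ˡ c) b b₁ c (sum₃ˡ-⊕ˡ b b₁ c l-b l₁ l-c) ρ≡ρ₁+ρ₁+ρ)

-- Every polynomial of a VNP₁ family is three-closed as a function on F₂^ℕ:
-- it is the fibre parity of a product of affine forms.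
VNP1-threeClosed : ∀ {f} → VNP1 f → ∀ n → ThreeClosed (λ ρ → eval ρ (f n))
VNP1-threeClosed {f} (g , (_ , _ , products) , p , q , _ , _ , f≈) n with products (q n)
... | L , _ , _ , L≈g = threeClosed-ext value (cubeParity-threeClosed (affineProduct-threeClosed L) (p n))
  where
  value : ∀ ρ → cubeParity (p n) (λ ε → eval ε (prodExpr (map affineExpr L))) ρ ≡ eval ρ (f n)
  value ρ = sym (begin
    eval ρ (f n)                                  ≡⟨ eval-≈ {f n} {cubeSum (p n) (g (q n))} (f≈ n) ρ ⟩
    eval ρ (cubeSum (p n) (g (q n)))              ≡⟨ eval-cubeSum (p n) (g (q n)) ρ ⟩
    cubeParity (p n) (λ ε → eval ε (g (q n))) ρ
      ≡⟨ cong xorList (map-cong (λ b → sym (eval-≈ {prodExpr (map affineExpr L)} {g (q n)} L≈g (b ▹ ρ)))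
                                (allBits (p n))) ⟩
    cubeParity (p n) (λ ε → eval ε (prodExpr (map affineExpr L))) ρ ∎)
    where open ≡-Reasoning

-- x₀ ∨ x₁ = x₀ + x₁ + x₀x₁ takes the value 1 at (1,0), (0,1), (1,1) but
-- not at their sum (0,0), so it is not three-closed.
orExpr : Expr
orExpr = var 0 ⊕ var 1 ⊕ var 0 ⊗ var 1

orExpr-not-threeClosed : ¬ ThreeClosed (λ ρ → eval ρ orExpr)
orExpr-not-threeClosed closed with closed corners refl refl refl
  where
  ρ₀₀ ρ₁₀ ρ₀₁ ρ₁₁ : ℕ → Bool
  ρ₀₀ _ = false
  ρ₁₀ i = i ≡ᵇ 0
  ρ₀₁ i = i ≡ᵇ 1
  ρ₁₁ i = (i ≡ᵇ 0) ∨ (i ≡ᵇ 1)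
  corners : Sum₃ ρ₀₀ ρ₁₀ ρ₀₁ ρ₁₁
  corners = sum₃ λ where
    zero          → refl
    (suc zero)    → refl
    (suc (suc i)) → refl
... | ()

constant-polyBounded : ∀ k → PolyBounded (λ _ → k)
constant-polyBounded k = k , λ n → m≤n+m k (k * n ^ k)

orFamily : Family
orFamily _ = orExpr

orFamily-VNP : VNP orFamily
orFamily-VNP =
  orFamily ,
  ((λ _ → 7) , constant-polyBounded 7 ,
   λ n → orExpr , ≤-refl , ((s≤s z≤n , s≤s (s≤s z≤n)) , (s≤s z≤n , s≤s (s≤s z≤n))) , λ m → refl) ,
  (λ _ → 0) , (λ _ → 0) , constant-polyBounded 0 , constant-polyBounded 0 ,
  λ n m → sym (xor-identityʳ (coeff orExpr m))

VNP⊈VNP1 : ¬ (VNP ⊆ᶜ VNP1)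
VNP⊈VNP1 VNP⊆VNP1 =
  orExpr-not-threeClosed (VNP1-threeClosed {orFamily} (VNP⊆VNP1 orFamily orFamily-VNP) 0)

proposition9p1 : VNP1 ⊊ᶜ VNP
proposition9p1 = VNP1⊆VNP , VNP⊈VNP1
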